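{- Let $n$ be even. The functions $\gamma_0,\gamma_2,\gamma_4,\dots,\gamma_{2n-2}:\mathbb{F}_2^n\to\mathbb{F}_2^n$ are linearly independent over $\mathbb{F}_2$ (as elements of the $\mathbb{F}_2$-vector space of all functions $\mathbb{F}_2^n\to\mathbb{F}_2^n$).
   Context: Let $\mathbbm{1}=(1,\dots,1)\in\mathbb{F}_2^n$, let $\odot$ denote component-wise multiplication of vectors in $\mathbb{F}_2^n$, and let $S:\mathbb{F}_2^n\to\mathbb{F}_2^n$ be the cyclic left shift $S(x_1,\dots,x_n)=(x_2,\dots,x_n,x_1)$. Define $\gamma_0=\mathrm{id}$ and, for $k\geq1$, $\gamma_{2k}(x)=S^{2k}(x)\odot(\mathbbm{1}+S^{2k-1}(x))\odot(\mathbbm{1}+S^{2k-3}(x))\odot\cdots\odot(\mathbbm{1}+S(x))$. -}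

module Defs where

open import Data.Bool using (Bool; true; false; _xor_; _∧_; not)
open import Data.Nat using (ℕ; zero; suc; _+_; _*_; _%_; NonZero)
open import Data.Fin using (Fin; toℕ; fromℕ<)
import Data.Fin as Fin
open import Data.Nat.DivMod using (m%n<n)

-- F₂ is modelled by Bool: addition = _xor_, multiplication = _∧_.
-- F₂ⁿ is modelled by functions Fin n → Bool (coordinate i ↔ x_{i+1}).
F2^ : ℕ → Set
F2^ n = Fin n → Bool

_⊕_ : ∀ {n} → F2^ n → F2^ n → F2^ n
(x ⊕ y) i = x i xor y i

_⊙_ : ∀ {n} → F2^ n → F2^ n → F2^ n
(x ⊙ y) i = x i ∧ y i

𝟙 : ∀ {n} → F2^ n
𝟙 i = true

𝟘 : ∀ {n} → F2^ n
𝟘 i = false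

S^ : ∀ {n} → ℕ → F2^ n → F2^ n
S^ {zero} k x ()
S^ {suc n} k x i = x (fromℕ< (m%n<n (toℕ i + k) (suc n)))

prodOdd : ∀ {n} → ℕ → F2^ n → F2^ n
prodOdd zero x = 𝟙
prodOdd (suc k) x = (𝟙 ⊕ S^ (2 * k + 1) x) ⊙ prodOdd k x

-- γ_{2k}(x) = S^{2k}(x) ⊙ (𝟙 + S^{2k-1}(x)) ⊙ ⋯ ⊙ (𝟙 + S(x));  γ_0 = id
γ : ∀ {n} → ℕ → F2^ n → F2^ n
γ zero x = x
γ (suc k) x = S^ (2 * suc k) x ⊙ prodOdd (suc k) x

-- F₂-linear combination  Σ_{j<m} c_j · γ_{2j}(x)  of functions F₂ⁿ → F₂ⁿ
-- (note: γ j above denotes γ_{2j}); evaluated pointwise in F₂ⁿ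
linComb : ∀ {n} (m : ℕ) → (Fin m → Bool) → F2^ n → F2^ n
linComb zero c x = 𝟘
linComb (suc m) c x = ((λ _ → c (Fin.fromℕ m)) ⊙ γ m x)
                      ⊕ linComb m (λ j → c (Fin.inject₁ j)) x

{-# OPTIONS --safe #-}
-- Only coordinate 0 is inspected, where γ_{2m}(x) = x_{2m mod n} ∧ ∏_{l<m} ¬x_{(2l+1) mod n}.
-- For a < n/2, at the point e_{2a} + e_{2a+1} the function γ_{2a} is the only γ_{2m} (m < n)
-- that is 1: smaller m miss the 1 at 2a, larger m see the 1 at the odd position 2a+1.
-- Hence c_a = 0. For a = b + n/2, the point e_{2b} has no odd support and 2m ≡ 2b (mod n)
-- iff m ≡ b (mod n/2), so exactly γ_{2b} and γ_{2a} are 1 there; since c_b = 0, also c_a = 0.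
module Submission where

open import Defs
open import Algebra.Bundles using (CommutativeMonoid; CommutativeRing)
import Algebra.Properties.CommutativeMonoid.Sum as CommutativeMonoidSum
open import Data.Bool using (Bool; true; false; _∧_; _xor_)
open import Data.Bool.Properties using (∧-identityʳ; ∧-zeroʳ; xor-comm; xor-∧-commutativeRing)
open import Data.Fin using (Fin; zero; toℕ; fromℕ; fromℕ<; inject₁)
open import Data.Fin.Properties
  using (toℕ-fromℕ; toℕ-inject₁; toℕ-fromℕ<; toℕ-injective; toℕ<n; punchInᵢ≢i)
open import Data.Nat using (ℕ; zero; suc; _+_; _*_; _%_; _/_; _<_; _≤_; s≤s; NonZero)
open import Data.Nat.DivMod
  using (m%n<n; m<n⇒m%n≡m; %-congˡ; %-congʳ; m%n*o≡m*o%[n*o]; m<n*o⇒m/o<n;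
         m≡m%n+[m/n]*n; [m+n]%n≡m%n)
open import Data.Nat.Properties
  using (_≟_; <-cmp; ≤-refl; <-trans; <⇒≢; m<n⇒m<1+n; m<1+n⇒m<n∨m≡n; even≢odd;
         +-comm; +-identityʳ; +-cancelʳ-≡; *-comm; *-cancelˡ-≡; *-monoʳ-≤; *-monoʳ-<; m*n≢0)
open import Data.Nat.Tactic.RingSolver using (solve-∀)
open import Data.Sum using (_⊎_; inj₁; inj₂; [_,_]′)
open import Data.Vec.Functional using (replicate; removeAt)
open import Function using (_∘_)
open import Relation.Binary.Definitions using (tri<; tri≈; tri>)
open import Relation.Binary.PropositionalEquality
  using (_≡_; _≢_; refl; sym; trans; cong; cong₂; subst; module ≡-Reasoning)
open import Relation.Nullary using (does; yes; no; contradiction)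
open import Relation.Nullary.Decidable using (dec-true; dec-false)

module _ {a ℓ} (M : CommutativeMonoid a ℓ) where
  open CommutativeMonoid M
  open CommutativeMonoidSum M using (sum; sum-remove; sum-cong-≋; sum-replicate-zero)
  open import Relation.Binary.Reasoning.Setoid setoid

  sum-vanishing-off : ∀ {m} (f : Fin m → Carrier) (t : Fin m) →
                 (∀ j → j ≢ t → f j ≈ ε) → sum f ≈ f t
  sum-vanishing-off {suc m} f t vanishes-off-t = begin
    sum f                      ≈⟨ sum-remove {i = t} f ⟩
    f t ∙ sum (removeAt f t)   ≈⟨ ∙-congˡ (sum-cong-≋ (λ j → vanishes-off-t _ (punchInᵢ≢i t j))) ⟩
    f t ∙ sum (replicate m ε)  ≈⟨ ∙-congˡ (sum-replicate-zero m) ⟩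
    f t ∙ ε                    ≈⟨ identityʳ (f t) ⟩
    f t                        ∎

xor-commutativeMonoid : CommutativeMonoid _ _
xor-commutativeMonoid = CommutativeRing.+-commutativeMonoid xor-∧-commutativeRing

open CommutativeMonoidSum xor-commutativeMonoid
  using (sum-init-last; sum-cong-≗) renaming (sum to xor-sum)

linComb-≡-xor-sum : ∀ {n} m (c : Fin m → Bool) (x : F2^ n) i →
                    linComb m c x i ≡ xor-sum (λ j → c j ∧ γ (toℕ j) x i)
linComb-≡-xor-sum zero    c x i = refl
linComb-≡-xor-sum (suc m) c x i = begin
  last-term xor linComb m (λ j → c (inject₁ j)) x i
    ≡⟨ xor-comm last-term _ ⟩
  linComb m (λ j → c (inject₁ j)) x i xor last-term
    ≡⟨ cong₂ _xor_ (trans (linComb-≡-xor-sum m _ x i) (sum-cong-≗ init-terms))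
                   (cong (λ z → c (fromℕ m) ∧ γ z x i) (sym (toℕ-fromℕ m))) ⟩
  xor-sum (λ j → term (inject₁ j)) xor term (fromℕ m)
    ≡⟨ sym (sum-init-last term) ⟩
  xor-sum term ∎
  where
  open ≡-Reasoning
  term : Fin (suc m) → Bool
  term j = c j ∧ γ (toℕ j) x i
  last-term : Bool
  last-term = c (fromℕ m) ∧ γ m x i
  init-terms : ∀ j → c (inject₁ j) ∧ γ (toℕ j) x i ≡ term (inject₁ j)
  init-terms j = cong (λ z → c (inject₁ j) ∧ γ z x i) (sym (toℕ-inject₁ j))

linComb-isolates : ∀ {n m} (c : Fin m → Bool) (x : F2^ n) i (t : Fin m) →
                   γ (toℕ t) x i ≡ true →
                   (∀ j → j ≢ t → c j ∧ γ (toℕ j) x i ≡ false) →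
                   linComb m c x i ≡ c t
linComb-isolates {m = m} c x i t γₜ≡true others = begin
  linComb m c x i                          ≡⟨ linComb-≡-xor-sum m c x i ⟩
  xor-sum (λ j → c j ∧ γ (toℕ j) x i)      ≡⟨ sum-vanishing-off xor-commutativeMonoid _ t others ⟩
  c t ∧ γ (toℕ t) x i                      ≡⟨ cong (c t ∧_) γₜ≡true ⟩
  c t ∧ true                               ≡⟨ ∧-identityʳ (c t) ⟩
  c t                                      ∎
  where open ≡-Reasoning

S^-zero : ∀ {n} (x : F2^ n) i → S^ 0 x i ≡ x i
S^-zero {suc n} x i = cong x (toℕ-injective (begin
  toℕ (fromℕ< (m%n<n (toℕ i + 0) (suc n)))  ≡⟨ toℕ-fromℕ< _ ⟩
  (toℕ i + 0) % suc n                       ≡⟨ cong (_% suc n) (+-identityʳ (toℕ i)) ⟩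
  toℕ i % suc n                             ≡⟨ m<n⇒m%n≡m (toℕ<n i) ⟩
  toℕ i                                     ∎))
  where open ≡-Reasoning

γ-≡-S^-∧-prodOdd : ∀ {n} m (x : F2^ n) i → γ m x i ≡ S^ (2 * m) x i ∧ prodOdd m x i
γ-≡-S^-∧-prodOdd zero    x i = sym (trans (∧-identityʳ _) (S^-zero x i))
γ-≡-S^-∧-prodOdd (suc m) x i = refl

prodOdd-≡-true : ∀ {n} m (x : F2^ n) i →
                 (∀ l → l < m → S^ (2 * l + 1) x i ≡ false) → prodOdd m x i ≡ true
prodOdd-≡-true zero    x i odd-off = refl
prodOdd-≡-true (suc m) x i odd-off =
  cong₂ (λ u v → (true xor u) ∧ v) (odd-off m ≤-refl)
        (prodOdd-≡-true m x i (λ l l<m → odd-off l (m<n⇒m<1+n l<m)))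

prodOdd-≡-false : ∀ {n} m (x : F2^ n) i {l} → l < m →
                  S^ (2 * l + 1) x i ≡ true → prodOdd m x i ≡ false
prodOdd-≡-false (suc m) x i {l} l<1+m odd-on with m<1+n⇒m<n∨m≡n l<1+m
... | inj₁ l<m  = trans (cong ((true xor S^ (2 * m + 1) x i) ∧_) (prodOdd-≡-false m x i l<m odd-on))
                        (∧-zeroʳ _)
... | inj₂ refl = cong (λ u → (true xor u) ∧ prodOdd m x i) odd-on

γ-≡-true : ∀ {n} m (x : F2^ n) i → S^ (2 * m) x i ≡ true →
           (∀ l → l < m → S^ (2 * l + 1) x i ≡ false) → γ m x i ≡ true
γ-≡-true m x i even-on odd-off = trans (γ-≡-S^-∧-prodOdd m x i)
  (cong₂ _∧_ even-on (prodOdd-≡-true m x i odd-off))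

γ-≡-false-even : ∀ {n} m (x : F2^ n) i → S^ (2 * m) x i ≡ false → γ m x i ≡ false
γ-≡-false-even m x i even-off = trans (γ-≡-S^-∧-prodOdd m x i)
  (cong (_∧ prodOdd m x i) even-off)

γ-≡-false-odd : ∀ {n} m (x : F2^ n) i {l} → l < m → S^ (2 * l + 1) x i ≡ true → γ m x i ≡ false
γ-≡-false-odd m x i l<m odd-on = trans (γ-≡-S^-∧-prodOdd m x i)
  (trans (cong (S^ (2 * m) x i ∧_) (prodOdd-≡-false m x i l<m odd-on)) (∧-zeroʳ _))

even≢odd′ : ∀ m l → 2 * m ≢ 2 * l + 1
even≢odd′ m l 2*m≡2*l+1 = even≢odd m l (trans 2*m≡2*l+1 (+-comm (2 * l) 1))

2*m+1-injective : ∀ {l m} → 2 * l + 1 ≡ 2 * m + 1 → l ≡ m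
2*m+1-injective {l} {m} eq = *-cancelˡ-≡ l m 2 (+-cancelʳ-≡ 1 (2 * l) (2 * m) eq)

module _ (k : ℕ) .{{_ : NonZero k}} where
  private instance
    2*k≢0 : NonZero (2 * k)
    2*k≢0 = m*n≢0 2 k

  m<k⇒2*m+1<2*k : ∀ {m} → m < k → 2 * m + 1 < 2 * k
  m<k⇒2*m+1<2*k {m} m<k = subst (_≤ 2 * k) (2*[1+m]≡1+[2*m+1] m) (*-monoʳ-≤ 2 m<k)
    where
    2*[1+m]≡1+[2*m+1] : ∀ m → 2 * suc m ≡ suc (2 * m + 1)
    2*[1+m]≡1+[2*m+1] = solve-∀

  [2*m]%[2*k]≡2*[m%k] : ∀ m → (2 * m) % (2 * k) ≡ 2 * (m % k)
  [2*m]%[2*k]≡2*[m%k] m = begin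
    (2 * m) % (2 * k)  ≡⟨ %-congˡ {o = 2 * k} (*-comm 2 m) ⟩
    (m * 2) % (2 * k)  ≡⟨ %-congʳ (*-comm 2 k) ⟩
    (m * 2) % (k * 2)  ≡⟨ sym (m%n*o≡m*o%[n*o] m k 2) ⟩
    m % k * 2          ≡⟨ *-comm (m % k) 2 ⟩
    2 * (m % k)        ∎
    where
    open ≡-Reasoning
    instance _ = m*n≢0 k 2

  m<2*k⇒m≡m%k⊎m≡m%k+k : ∀ {m} → m < 2 * k → m ≡ m % k ⊎ m ≡ m % k + k
  m<2*k⇒m≡m%k⊎m≡m%k+k {m} m<2*k
    with m / k | m<n*o⇒m/o<n {m} {2} {k} m<2*k | m≡m%n+[m/n]*n m k
  ... | 0 | _ | m≡r+0 = inj₁ (trans m≡r+0 (+-identityʳ (m % k)))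
  ... | 1 | _ | m≡r+k+0 = inj₂ (trans m≡r+k+0 (cong (m % k +_) (+-identityʳ k)))
  ... | suc (suc _) | s≤s (s≤s ()) | _

  [2*m]%[2*k]≡2*b⇒m≡b⊎m≡b+k : ∀ {m b} → m < 2 * k → (2 * m) % (2 * k) ≡ 2 * b →
                             m ≡ b ⊎ m ≡ b + k
  [2*m]%[2*k]≡2*b⇒m≡b⊎m≡b+k {m} {b} m<2*k [2*m]%[2*k]≡2*b =
    subst (λ r → m ≡ r ⊎ m ≡ r + k) m%k≡b (m<2*k⇒m≡m%k⊎m≡m%k+k m<2*k)
    where
    m%k≡b : m % k ≡ b
    m%k≡b = *-cancelˡ-≡ (m % k) b 2 (trans (sym ([2*m]%[2*k]≡2*[m%k] m)) [2*m]%[2*k]≡2*b)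

  [2*[b+k]]%[2*k]≡2*b : ∀ {b} → b < k → (2 * (b + k)) % (2 * k) ≡ 2 * b
  [2*[b+k]]%[2*k]≡2*b {b} b<k = begin
    (2 * (b + k)) % (2 * k)  ≡⟨ [2*m]%[2*k]≡2*[m%k] (b + k) ⟩
    2 * ((b + k) % k)        ≡⟨ cong (2 *_) ([m+n]%n≡m%n b k) ⟩
    2 * (b % k)              ≡⟨ cong (2 *_) (m<n⇒m%n≡m b<k) ⟩
    2 * b                    ∎
    where open ≡-Reasoning

  [2*l+1]%[2*k]≢2*b : ∀ l b → (2 * l + 1) % (2 * k) ≢ 2 * b
  [2*l+1]%[2*k]≢2*b l b r≡2*b = even≢odd (b + q * k) l (begin
    2 * (b + q * k)        ≡⟨ distrib b q k ⟩
    2 * b + q * (2 * k)    ≡⟨ cong (_+ q * (2 * k)) r≡2*b ⟨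
    r + q * (2 * k)        ≡⟨ m≡m%n+[m/n]*n (2 * l + 1) (2 * k) ⟨
    2 * l + 1              ≡⟨ +-comm (2 * l) 1 ⟩
    suc (2 * l)            ∎)
    where
    open ≡-Reasoning
    r = (2 * l + 1) % (2 * k)
    q = (2 * l + 1) / (2 * k)
    distrib : ∀ b q k → 2 * (b + q * k) ≡ 2 * b + q * (2 * k)
    distrib = solve-∀

unit : ∀ {n} → ℕ → F2^ n
unit p i = does (toℕ i ≟ p)

S^-unit-zero : ∀ {n} s p → S^ s (unit {suc n} p) zero ≡ does (s % suc n ≟ p)
S^-unit-zero {n} s p = cong (λ y → does (y ≟ p)) (toℕ-fromℕ< (m%n<n s (suc n)))

-- k = suc k′ makes n = 2 * k a successor, so that coordinate zero exists and S^ computes.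
module _ (k′ : ℕ) where
  private
    k = suc k′
    n = 2 * k

  low-point : ℕ → F2^ n
  low-point a = unit (2 * a) ⊕ unit (2 * a + 1)

  high-point : ℕ → F2^ n
  high-point b = unit (2 * b)

  S^-low-point-zero : ∀ {s} a → s < n →
                      S^ s (low-point a) zero ≡ does (s ≟ 2 * a) xor does (s ≟ 2 * a + 1)
  S^-low-point-zero {s} a s<n = cong₂ _xor_
    (trans (S^-unit-zero s (2 * a)) (cong (λ y → does (y ≟ 2 * a)) s%n≡s))
    (trans (S^-unit-zero s (2 * a + 1)) (cong (λ y → does (y ≟ 2 * a + 1)) s%n≡s))
    where
    s%n≡s : s % n ≡ s
    s%n≡s = m<n⇒m%n≡m s<n

  γ-low-point-on : ∀ {a} → a < k → γ a (low-point a) zero ≡ true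
  γ-low-point-on {a} a<k = γ-≡-true a (low-point a) zero
    (trans (S^-low-point-zero a (*-monoʳ-< 2 a<k))
           (cong₂ _xor_ (dec-true (2 * a ≟ 2 * a) refl)
                        (dec-false (2 * a ≟ 2 * a + 1) (even≢odd′ a a))))
    (λ l l<a → trans (S^-low-point-zero a (m<k⇒2*m+1<2*k k (<-trans l<a a<k)))
      (cong₂ _xor_ (dec-false (_ ≟ 2 * a) (even≢odd′ a l ∘ sym))
                   (dec-false (_ ≟ 2 * a + 1) (<⇒≢ l<a ∘ 2*m+1-injective))))

  γ-low-point-off : ∀ {a m} → a < k → m ≢ a → γ m (low-point a) zero ≡ false
  γ-low-point-off {a} {m} a<k m≢a with <-cmp m a
  ... | tri< m<a _ _ = γ-≡-false-even m (low-point a) zero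
    (trans (S^-low-point-zero a (*-monoʳ-< 2 (<-trans m<a a<k)))
      (cong₂ _xor_ (dec-false (2 * m ≟ 2 * a) (m≢a ∘ *-cancelˡ-≡ m a 2))
                   (dec-false (2 * m ≟ 2 * a + 1) (even≢odd′ m a))))
  ... | tri≈ _ m≡a _ = contradiction m≡a m≢a
  ... | tri> _ _ a<m = γ-≡-false-odd m (low-point a) zero a<m
    (trans (S^-low-point-zero a (m<k⇒2*m+1<2*k k a<k))
      (cong₂ _xor_ (dec-false (2 * a + 1 ≟ 2 * a) (even≢odd′ a a ∘ sym))
                   (dec-true (2 * a + 1 ≟ 2 * a + 1) refl)))

  γ-high-point-on : ∀ {b} → b < k → γ (b + k) (high-point b) zero ≡ true
  γ-high-point-on {b} b<k = γ-≡-true (b + k) (high-point b) zero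
    (trans (S^-unit-zero (2 * (b + k)) (2 * b))
           (dec-true (_ ≟ 2 * b) ([2*[b+k]]%[2*k]≡2*b k b<k)))
    (λ l _ → trans (S^-unit-zero (2 * l + 1) (2 * b))
                   (dec-false (_ ≟ 2 * b) ([2*l+1]%[2*k]≢2*b k l b)))

  γ-high-point-off : ∀ {b m} → m < n → m ≢ b → m ≢ b + k → γ m (high-point b) zero ≡ false
  γ-high-point-off {b} {m} m<n m≢b m≢b+k = γ-≡-false-even m (high-point b) zero
    (trans (S^-unit-zero (2 * m) (2 * b))
           (dec-false (_ ≟ 2 * b) ([ m≢b , m≢b+k ]′ ∘ [2*m]%[2*k]≡2*b⇒m≡b⊎m≡b+k k m<n)))

  module _ (c : Fin n → Bool)
           (combination-vanishes : (x : F2^ n) (i : Fin n) → linComb n c x i ≡ false) where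

    isolated-coefficient-vanishes : ∀ (x : F2^ n) t → γ (toℕ t) x zero ≡ true →
                                    (∀ j → j ≢ t → c j ∧ γ (toℕ j) x zero ≡ false) → c t ≡ false
    isolated-coefficient-vanishes x t γₜ≡true others =
      trans (sym (linComb-isolates c x zero t γₜ≡true others)) (combination-vanishes x zero)

    low-coefficient-vanishes : ∀ t → toℕ t < k → c t ≡ false
    low-coefficient-vanishes t t<k =
      isolated-coefficient-vanishes (low-point (toℕ t)) t (γ-low-point-on t<k) λ j j≢t →
        trans (cong (c j ∧_) (γ-low-point-off t<k (j≢t ∘ toℕ-injective))) (∧-zeroʳ (c j))

    high-coefficient-vanishes : ∀ t {b} → b < k → toℕ t ≡ b + k → c t ≡ false
    high-coefficient-vanishes t {b} b<k t≡b+k =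
      isolated-coefficient-vanishes (high-point b) t
        (subst (λ m → γ m (high-point b) zero ≡ true) (sym t≡b+k) (γ-high-point-on b<k)) others
      where
      others : ∀ j → j ≢ t → c j ∧ γ (toℕ j) (high-point b) zero ≡ false
      others j j≢t with toℕ j ≟ b
      ... | yes j≡b = cong (_∧ _) (low-coefficient-vanishes j (subst (_< k) (sym j≡b) b<k))
      ... | no j≢b  = trans (cong (c j ∧_) (γ-high-point-off (toℕ<n j) j≢b
                              (j≢t ∘ toℕ-injective ∘ λ j≡b+k → trans j≡b+k (sym t≡b+k))))
                            (∧-zeroʳ (c j))

    coefficients-vanish : ∀ t → c t ≡ false
    coefficients-vanish t with m<2*k⇒m≡m%k⊎m≡m%k+k k (toℕ<n t)
    ... | inj₁ t≡t%k   = low-coefficient-vanishes t (subst (_< k) (sym t≡t%k) (m%n<n (toℕ t) k))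
    ... | inj₂ t≡t%k+k = high-coefficient-vanishes t (m%n<n (toℕ t) k) t≡t%k+k

lemma4 : (k : ℕ) → let n = 2 * k in
    (c : Fin n → Bool) →
    ((x : F2^ n) (i : Fin n) → linComb {n} n c x i ≡ false) →
    (j : Fin n) → c j ≡ false
lemma4 zero      c combination-vanishes ()
lemma4 (suc k′)  c combination-vanishes = coefficients-vanish k′ c combination-vanishes
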